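{- For $n\ge0$ let $C_n(a,r)=\sum_{m=0}^{n}\binom{n}{m}(a)_m r^{n-m}$, where $(u)_m=u(u+1)\cdots(u+m-1)$. Then, as formal power series in $y,z$ (with $a,b,c,r,s,t$ indeterminates), \[ \sum_{m,n\ge0} C_{m}(a,r)\, C_{n}(b,s)\, C_{m+n}(c,t)\, \frac{y^m}{m!}\frac{z^n}{n!} = e^{(ry+sz)t}\sum_{m,n\ge0}\frac{(a)_{m}\,(b)_{n}\,(c)_{m+n}}{(1-ty)^{m+a}\,(1-tz)^{n+b}\,(1-ry-sz)^{m+n+c}}\,\frac{y^m}{m!}\frac{z^n}{n!}. \]
   Context: $(1-w)^{ -e}$ for an indeterminate exponent $e$ and a power series $w$ without constant term denotes the formal binomial series $\sum_{m\ge0}(e)_m w^m/m!$. -}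

module Defs where

open import Level using (Level)
open import Data.Nat as ℕ using (ℕ; zero; suc; _∸_)
open import Data.Nat.Combinatorics using (_C_)
open import Algebra.Bundles using (CommutativeRing)

-- Formal power series in two variables y, z over a commutative ring R,
-- where `inv n` is meant to be the inverse of (n+1)·1 in R
-- (the hypothesis is imposed in the statement).
module FPS {c ℓ : Level} (R : CommutativeRing c ℓ) (inv : ℕ → CommutativeRing.Carrier R) where
  open CommutativeRing R

  fromℕ : ℕ → Carrier
  fromℕ zero    = 0#
  fromℕ (suc n) = 1# + fromℕ n

  pow : Carrier → ℕ → Carrier
  pow x zero    = 1#
  pow x (suc n) = x * pow x n

  sumTo : ℕ → (ℕ → Carrier) → Carrier
  sumTo zero    f = f 0
  sumTo (suc n) f = sumTo n f + f (suc n)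

  poch : Carrier → ℕ → Carrier
  poch u zero    = 1#
  poch u (suc m) = poch u m * (u + fromℕ m)

  invFact : ℕ → Carrier
  invFact zero    = 1#
  invFact (suc m) = invFact m * inv m

  Cpoly : ℕ → Carrier → Carrier → Carrier
  Cpoly n a r = sumTo n (λ m → fromℕ (n C m) * poch a m * pow r (n ∸ m))

  -- a power series in y,z: F M N = coefficient of y^M z^N
  Series : Set c
  Series = ℕ → ℕ → Carrier

  one : Series
  one zero zero = 1#
  one _    _    = 0#

  lin : Carrier → Carrier → Series
  lin p q 1 0 = p
  lin p q 0 1 = q
  lin p q _ _ = 0#

  _·_ : Carrier → Series → Series
  (x · F) M N = x * F M N

  _⊛_ : Series → Series → Series
  (F ⊛ G) M N = sumTo M (λ i → sumTo N (λ j → F i j * G (M ∸ i) (N ∸ j)))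

  powS : Series → ℕ → Series
  powS w zero    = one
  powS w (suc k) = w ⊛ powS w k

  -- Σ_{k≥0} f k · w^k for a series w WITHOUT constant term
  -- (then w^k has no terms of total degree < k, so the coefficient of
  -- y^M z^N only receives contributions from k ≤ M+N)
  compose : (ℕ → Carrier) → Series → Series
  compose f w M N = sumTo (M ℕ.+ N) (λ k → f k * powS w k M N)

  -- (1-w)^{-e} = Σ_m (e)_m w^m / m!
  binomS : Carrier → Series → Series
  binomS e w = compose (λ m → poch e m * invFact m) w

  expS : Series → Series
  expS w = compose invFact w

  -- Σ_{m,n≥0} y^m z^n · G m n  (summable family: the coefficient of y^M z^N
  -- only receives contributions from m ≤ M, n ≤ N)
  familySum : (ℕ → ℕ → Series) → Series
  familySum G M N = sumTo M (λ m → sumTo N (λ n → G m n (M ∸ m) (N ∸ n)))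

  LHS : (a b c r s t : Carrier) → Series
  LHS a b c r s t M N =
    Cpoly M a r * Cpoly N b s * Cpoly (M ℕ.+ N) c t * invFact M * invFact N

  RHS : (a b c r s t : Carrier) → Series
  RHS a b c r s t =
    expS (lin (r * t) (s * t)) ⊛
    familySum (λ m n →
      (poch a m * poch b n * poch c (m ℕ.+ n) * invFact m * invFact n) ·
      ((binomS (fromℕ m + a) (lin t 0#) ⊛ binomS (fromℕ n + b) (lin 0# t))
        ⊛ binomS (fromℕ (m ℕ.+ n) + c) (lin r s)))

-- Write BC n g = Σ_i binom(n,i) g i (n-i) for the binomial convolution and
-- Binom x n ψ = Σ_i binom(n,i) ψ i x^(n-i), so that C_n(u,x) = Binom x n ((u)_·).
-- After multiplying the coefficient of y^M z^N by M! N!, every exponential-type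
-- product on the right (e^w and (1-w)^{-e} for linear w, the family sum with its
-- weights y^m/m! z^n/n!) becomes a binomial convolution, so the right-hand side
-- is a six-fold nested convolution `rhsCore M N`.  The heart of the proof is a
-- one-variable identity: for every doubly indexed Φ, a triple convolution
-- weighted by (xy)^u y^i x^p equals the double transform
-- Binom x M (λ α → Binom y M (Φ α)); both sides obey the same recursion in M,
-- which comes from Pascal's rule.  Applying it in the z-direction and then in
-- the y-direction, and finishing with the Vandermonde identity for (c)_{m+n},
-- identifies rhsCore M N with C_M(a,r) C_N(b,s) C_{M+N}(c,t).
module Submission where

open import Defs
open import Level using (Level)
open import Data.Nat as ℕ using (ℕ; zero; suc; _∸_; _≤_; _<_; z≤n; s≤s; _!)
import Data.Nat.Properties as ℕₚ
open import Data.Nat.Combinatorics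
  using (_C_; nCn≡1; nCk≡n!/k![n-k]!; k![n∸k]!∣n!; k>n⇒nCk≡0; nCk+nC[k+1]≡[n+1]C[k+1])
open import Data.Nat.DivMod using (m/n*n≡m)
open import Data.Empty using (⊥-elim)
open import Function using (_∘_)
open import Algebra.Bundles using (CommutativeRing)
import Relation.Binary.PropositionalEquality as Eq
import Relation.Binary.Reasoning.Setoid as SetoidReasoning
open Eq using (_≡_; _≢_)

binomial·factorials : ∀ {n k} → k ≤ n → (n C k) ℕ.* (k ! ℕ.* (n ∸ k) !) ≡ n !
binomial·factorials {n} {k} k≤n =
  Eq.trans (Eq.cong (ℕ._* (k ! ℕ.* (n ∸ k) !)) (nCk≡n!/k![n-k]! k≤n))
           (m/n*n≡m {{ℕₚ._!*_!≢0 k (n ∸ k)}} (k![n∸k]!∣n! k≤n))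

-- `inv` only fixes the namespace of Defs; the hypothesis that it inverts the
-- positive integers is assumed from the section on factorials onwards.
module Development {c ℓ : Level} (R : CommutativeRing c ℓ)
                   (inv : ℕ → CommutativeRing.Carrier R) where
  open CommutativeRing R
  open FPS R inv
  open SetoidReasoning setoid
  open import Algebra.Solver.Ring.NaturalCoefficients.Default commutativeSemiring

  sum-cong≤ : ∀ n {f g : ℕ → Carrier} → (∀ i → i ≤ n → f i ≈ g i) → sumTo n f ≈ sumTo n g
  sum-cong≤ zero    f≈g = f≈g 0 z≤n
  sum-cong≤ (suc n) f≈g =
    +-cong (sum-cong≤ n (λ i i≤n → f≈g i (ℕₚ.m≤n⇒m≤1+n i≤n))) (f≈g (suc n) ℕₚ.≤-refl)

  sum-cong : ∀ n {f g : ℕ → Carrier} → (∀ i → f i ≈ g i) → sumTo n f ≈ sumTo n g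
  sum-cong n f≈g = sum-cong≤ n (λ i _ → f≈g i)

  sum-+ : ∀ n (f g : ℕ → Carrier) → sumTo n (λ i → f i + g i) ≈ sumTo n f + sumTo n g
  sum-+ zero    f g = refl
  sum-+ (suc n) f g = begin
    sumTo n (λ i → f i + g i) + (f (suc n) + g (suc n))
      ≈⟨ +-congʳ (sum-+ n f g) ⟩
    (sumTo n f + sumTo n g) + (f (suc n) + g (suc n))
      ≈⟨ solve 4 (λ a b x y → (a :+ b) :+ (x :+ y) := (a :+ x) :+ (b :+ y)) refl
               (sumTo n f) (sumTo n g) (f (suc n)) (g (suc n)) ⟩
    (sumTo n f + f (suc n)) + (sumTo n g + g (suc n)) ∎

  sum-*ˡ : ∀ n x (f : ℕ → Carrier) → x * sumTo n f ≈ sumTo n (λ i → x * f i)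
  sum-*ˡ zero    x f = refl
  sum-*ˡ (suc n) x f = trans (distribˡ x (sumTo n f) (f (suc n))) (+-congʳ (sum-*ˡ n x f))

  sum-zero : ∀ n {f : ℕ → Carrier} → (∀ i → i ≤ n → f i ≈ 0#) → sumTo n f ≈ 0#
  sum-zero zero    f≈0 = f≈0 0 z≤n
  sum-zero (suc n) f≈0 =
    trans (+-cong (sum-zero n (λ i i≤n → f≈0 i (ℕₚ.m≤n⇒m≤1+n i≤n))) (f≈0 (suc n) ℕₚ.≤-refl))
          (+-identityˡ 0#)

  *≈0 : ∀ x {a} → a ≈ 0# → x * a ≈ 0#
  *≈0 x a≈0 = trans (*-congˡ a≈0) (zeroʳ x)

  +≈0 : ∀ {a b} → a ≈ 0# → b ≈ 0# → a + b ≈ 0#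
  +≈0 a≈0 b≈0 = trans (+-cong a≈0 b≈0) (+-identityʳ 0#)

  sum-swap : ∀ m n (f : ℕ → ℕ → Carrier) →
    sumTo m (λ i → sumTo n (f i)) ≈ sumTo n (λ j → sumTo m (λ i → f i j))
  sum-swap zero    n f = refl
  sum-swap (suc m) n f =
    trans (+-congʳ (sum-swap m n f)) (sym (sum-+ n (λ j → sumTo m (λ i → f i j)) (f (suc m))))

  sum-front : ∀ n (f : ℕ → Carrier) → sumTo (suc n) f ≈ f 0 + sumTo n (λ i → f (suc i))
  sum-front zero    f = refl
  sum-front (suc n) f = trans (+-congʳ (sum-front n f)) (+-assoc _ _ _)

  sum-last-only : ∀ n {f : ℕ → Carrier} → (∀ i → i < n → f i ≈ 0#) → sumTo n f ≈ f n
  sum-last-only zero    f≈0 = refl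
  sum-last-only (suc n) f≈0 =
    trans (+-congʳ (sum-zero n (λ i i≤n → f≈0 i (s≤s i≤n)))) (+-identityˡ _)

  sum-first-only : ∀ n {f : ℕ → Carrier} → (∀ i → f (suc i) ≈ 0#) → sumTo n f ≈ f 0
  sum-first-only zero    f≈0 = refl
  sum-first-only (suc n) f≈0 = trans (+-cong (sum-first-only n f≈0) (f≈0 n)) (+-identityʳ _)

  fromℕ-+ : ∀ m n → fromℕ (m ℕ.+ n) ≈ fromℕ m + fromℕ n
  fromℕ-+ zero    n = sym (+-identityˡ _)
  fromℕ-+ (suc m) n = trans (+-congˡ (fromℕ-+ m n)) (sym (+-assoc _ _ _))

  fromℕ-* : ∀ m n → fromℕ (m ℕ.* n) ≈ fromℕ m * fromℕ n
  fromℕ-* zero    n = sym (zeroˡ _)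
  fromℕ-* (suc m) n = begin
    fromℕ (n ℕ.+ m ℕ.* n)         ≈⟨ fromℕ-+ n (m ℕ.* n) ⟩
    fromℕ n + fromℕ (m ℕ.* n)     ≈⟨ +-congˡ (fromℕ-* m n) ⟩
    fromℕ n + fromℕ m * fromℕ n
      ≈⟨ solve 2 (λ a b → b :+ a :* b := (con 1 :+ a) :* b) refl (fromℕ m) (fromℕ n) ⟩
    (1# + fromℕ m) * fromℕ n      ∎

  fromℕ-1 : fromℕ 1 ≈ 1#
  fromℕ-1 = +-identityʳ 1#

  fromℕ-pascal : ∀ n i → fromℕ (suc n C suc i) ≈ fromℕ (n C i) + fromℕ (n C suc i)
  fromℕ-pascal n i =
    trans (reflexive (Eq.cong fromℕ (Eq.sym (nCk+nC[k+1]≡[n+1]C[k+1] n i)))) (fromℕ-+ (n C i) (n C suc i))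

  -- 0^k = 0 for k ≠ 0; it makes the series in y alone vanish off the y-axis.
  pow-0# : ∀ k → k ≢ 0 → pow 0# k ≈ 0#
  pow-0# zero    k≢0 = ⊥-elim (k≢0 Eq.refl)
  pow-0# (suc k) k≢0 = zeroˡ _

  poch-+ : ∀ u m i → poch u m * poch (fromℕ m + u) i ≈ poch u (m ℕ.+ i)
  poch-+ u m zero    = trans (*-identityʳ _) (reflexive (Eq.cong (poch u) (Eq.sym (ℕₚ.+-identityʳ m))))
  poch-+ u m (suc i) = begin
    poch u m * (poch (fromℕ m + u) i * (fromℕ m + u + fromℕ i)) ≈⟨ sym (*-assoc _ _ _) ⟩
    poch u m * poch (fromℕ m + u) i * (fromℕ m + u + fromℕ i)
      ≈⟨ *-cong (poch-+ u m i)
                (trans (solve 3 (λ a u b → a :+ u :+ b := u :+ (a :+ b)) refl (fromℕ m) u (fromℕ i))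
                       (+-congˡ (sym (fromℕ-+ m i)))) ⟩
    poch u (suc (m ℕ.+ i))                                      ≈⟨ reflexive (Eq.cong (poch u) (Eq.sym (ℕₚ.+-suc m i))) ⟩
    poch u (m ℕ.+ suc i)                                        ∎

  opaque
    BC : ℕ → (ℕ → ℕ → Carrier) → Carrier
    BC n g = sumTo n (λ i → fromℕ (n C i) * g i (n ∸ i))

    BC-unfold : ∀ n g → BC n g ≈ sumTo n (λ i → fromℕ (n C i) * g i (n ∸ i))
    BC-unfold n g = refl

    BC-cong : ∀ n {g h : ℕ → ℕ → Carrier} → (∀ i j → g i j ≈ h i j) → BC n g ≈ BC n h
    BC-cong n g≈h = sum-cong n (λ i → *-congˡ (g≈h i (n ∸ i)))

    BC-+ : ∀ n (g h : ℕ → ℕ → Carrier) → BC n (λ i j → g i j + h i j) ≈ BC n g + BC n h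
    BC-+ n g h = trans (sum-cong n (λ i → distribˡ _ _ _)) (sum-+ n _ _)

    BC-*ˡ : ∀ n x (g : ℕ → ℕ → Carrier) → x * BC n g ≈ BC n (λ i j → x * g i j)
    BC-*ˡ n x g = trans (sum-*ˡ n x _)
      (sum-cong n (λ i → solve 3 (λ x b y → x :* (b :* y) := b :* (x :* y)) refl x _ _))

    BC-zero : ∀ (g : ℕ → ℕ → Carrier) → BC 0 g ≈ g 0 0
    BC-zero g = trans (*-congʳ fromℕ-1) (*-identityˡ _)

    BC-swap : ∀ m n (f : ℕ → ℕ → ℕ → ℕ → Carrier) →
      BC m (λ i k → BC n (f i k)) ≈ BC n (λ j l → BC m (λ i k → f i k j l))
    BC-swap m n f = begin
      sumTo m (λ i → fromℕ (m C i) * sumTo n (λ j → fromℕ (n C j) * f i (m ∸ i) j (n ∸ j)))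
        ≈⟨ sum-cong m (λ i → sum-*ˡ n _ _) ⟩
      sumTo m (λ i → sumTo n (λ j → fromℕ (m C i) * (fromℕ (n C j) * f i (m ∸ i) j (n ∸ j))))
        ≈⟨ sum-swap m n _ ⟩
      sumTo n (λ j → sumTo m (λ i → fromℕ (m C i) * (fromℕ (n C j) * f i (m ∸ i) j (n ∸ j))))
        ≈⟨ sum-cong n (λ j → sum-cong m (λ i →
             solve 3 (λ x b y → x :* (b :* y) := b :* (x :* y)) refl _ _ _)) ⟩
      sumTo n (λ j → sumTo m (λ i → fromℕ (n C j) * (fromℕ (m C i) * f i (m ∸ i) j (n ∸ j))))
        ≈⟨ sym (sum-cong n (λ j → sum-*ˡ m _ _)) ⟩
      sumTo n (λ j → fromℕ (n C j) * sumTo m (λ i → fromℕ (m C i) * f i (m ∸ i) j (n ∸ j))) ∎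

    -- Pascal's rule for convolutions: raising the order splits each term
    -- g i j into the two ways of reaching it from order n.
    BC-suc : ∀ n (g : ℕ → ℕ → Carrier) → BC (suc n) g ≈ BC n (λ i j → g (suc i) j + g i (suc j))
    BC-suc n g = begin
      BC (suc n) g                                  ≈⟨ sum-front n _ ⟩
      g₀ + sumTo n (λ i → fromℕ (suc n C suc i) * g (suc i) (n ∸ i))
        ≈⟨ +-congˡ (sum-cong n (λ i → trans (*-congʳ (fromℕ-pascal n i)) (distribʳ _ _ _))) ⟩
      g₀ + sumTo n (λ i → fromℕ (n C i) * g (suc i) (n ∸ i) + fromℕ (n C suc i) * g (suc i) (n ∸ i))
        ≈⟨ +-congˡ (sum-+ n _ _) ⟩
      g₀ + (stepI + stepJ′)                         ≈⟨ solve 3 (λ x a b → x :+ (a :+ b) := a :+ (x :+ b)) refl g₀ stepI stepJ′ ⟩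
      stepI + (g₀ + stepJ′)                         ≈⟨ +-congˡ (sym stepJ≈) ⟩
      stepI + stepJ                                 ≈⟨ sym (BC-+ n (λ i j → g (suc i) j) (λ i j → g i (suc j))) ⟩
      BC n (λ i j → g (suc i) j + g i (suc j))      ∎
      where
      g₀ stepI stepJ stepJ′ : Carrier
      g₀     = fromℕ (suc n C 0) * g 0 (suc n)
      stepI  = sumTo n (λ i → fromℕ (n C i) * g (suc i) (n ∸ i))
      stepJ  = sumTo n (λ i → fromℕ (n C i) * g i (suc (n ∸ i)))
      stepJ′ = sumTo n (λ i → fromℕ (n C suc i) * g (suc i) (n ∸ i))
      -- the j-steps form the order-(n+1) sum with coefficients binom(n,·),
      -- whose last term binom(n,n+1) vanishes
      stepJ≈ : stepJ ≈ g₀ + stepJ′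
      stepJ≈ = begin
        stepJ
          ≈⟨ sum-cong≤ n (λ i i≤n → *-congˡ (reflexive (Eq.cong (g i) (Eq.sym (ℕₚ.+-∸-assoc 1 i≤n))))) ⟩
        sumTo n (λ i → fromℕ (n C i) * g i (suc n ∸ i))                 ≈⟨ sym (+-identityʳ _) ⟩
        sumTo n (λ i → fromℕ (n C i) * g i (suc n ∸ i)) + 0#
          ≈⟨ +-congˡ (sym (trans (*-congʳ (reflexive (Eq.cong fromℕ (k>n⇒nCk≡0 (ℕₚ.n<1+n n)))))
                                 (zeroˡ _))) ⟩
        sumTo (suc n) (λ i → fromℕ (n C i) * g i (suc n ∸ i))            ≈⟨ sum-front n _ ⟩
        g₀ + stepJ′                                                       ∎

  BC² : ℕ → ℕ → (ℕ → ℕ → ℕ → ℕ → Carrier) → Carrier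
  BC² m n h = BC m (λ i k → BC n (h i k))

  BC-*ˡ² : ∀ x m (n : ℕ → ℕ → ℕ) (f : ℕ → ℕ → ℕ → ℕ → Carrier) →
    x * BC m (λ i k → BC (n i k) (f i k)) ≈ BC m (λ i k → BC (n i k) (λ j l → x * f i k j l))
  BC-*ˡ² x m n f = trans (BC-*ˡ m x _) (BC-cong m (λ i k → BC-*ˡ (n i k) x (f i k)))

  BC-*ˡ³ : ∀ x m (n : ℕ → ℕ → ℕ) (f : ℕ → ℕ → ℕ → ℕ → ℕ → ℕ → Carrier) →
    x * BC m (λ i k → BC (n i k) (λ j l → BC l (f i k j l)))
      ≈ BC m (λ i k → BC (n i k) (λ j l → BC l (λ o w → x * f i k j l o w)))
  BC-*ˡ³ x m n f = trans (BC-*ˡ m x _) (BC-cong m (λ i k → BC-*ˡ² x (n i k) (λ _ l → l) (f i k)))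

  BC²-tower : ∀ M N (F : ℕ → ℕ → ℕ → ℕ → ℕ → ℕ → ℕ → ℕ → Carrier) →
    BC² M N (λ u P v Q → BC² P Q (λ m P₁ n Q₁ → BC² P₁ Q₁ (λ i p j q → F u m i p v n j q)))
      ≈ BC M (λ u P → BC P (λ m P₁ → BC P₁ (λ i p →
          BC N (λ v Q → BC Q (λ n Q₁ → BC Q₁ (λ j q → F u m i p v n j q))))))
  BC²-tower M N F = BC-cong M (λ u P →
    trans (BC-swap N P (λ v Q m P₁ → BC Q (λ n Q₁ → BC P₁ (λ i p → BC Q₁ (λ j q → F u m i p v n j q)))))
          (BC-cong P (λ m P₁ →
            trans (BC-cong N (λ v Q → BC-swap Q P₁ (λ n Q₁ i p → BC Q₁ (λ j q → F u m i p v n j q))))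
                  (BC-swap N P₁ (λ v Q i p → BC Q (λ n Q₁ → BC Q₁ (λ j q → F u m i p v n j q)))))))

  Binom : Carrier → ℕ → (ℕ → Carrier) → Carrier
  Binom x n ψ = BC n (λ i j → ψ i * pow x j)

  Cpoly≈Binom : ∀ n u x → Cpoly n u x ≈ Binom x n (poch u)
  Cpoly≈Binom n u x = sym (trans (BC-unfold n _) (sum-cong n (λ i → sym (*-assoc _ _ _))))

  Binom-cong : ∀ x n {φ ψ : ℕ → Carrier} → (∀ i → φ i ≈ ψ i) → Binom x n φ ≈ Binom x n ψ
  Binom-cong x n φ≈ψ = BC-cong n (λ i j → *-congʳ (φ≈ψ i))

  Binom-zero : ∀ x ψ → Binom x 0 ψ ≈ ψ 0
  Binom-zero x ψ = trans (BC-zero _) (*-identityʳ _)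

  Binom-suc : ∀ x n ψ → Binom x (suc n) ψ ≈ Binom x n (λ i → ψ (suc i) + x * ψ i)
  Binom-suc x n ψ = trans (BC-suc n _) (BC-cong n (λ i j →
    solve 4 (λ a b x p → a :* p :+ b :* (x :* p) := (a :+ x :* b) :* p) refl (ψ (suc i)) (ψ i) x (pow x j)))

  Binom-+ : ∀ x n φ ψ → Binom x n (λ i → φ i + ψ i) ≈ Binom x n φ + Binom x n ψ
  Binom-+ x n φ ψ = trans (BC-cong n (λ i j → distribʳ _ _ _)) (BC-+ n _ _)

  Binom-*ˡ : ∀ x n y ψ → y * Binom x n ψ ≈ Binom x n (λ i → y * ψ i)
  Binom-*ˡ x n y ψ = trans (BC-*ˡ n y _) (BC-cong n (λ i j → sym (*-assoc _ _ _)))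

  Binom-*ʳ : ∀ x n y ψ → Binom x n ψ * y ≈ Binom x n (λ i → ψ i * y)
  Binom-*ʳ x n y ψ = trans (*-comm _ y) (trans (Binom-*ˡ x n y ψ) (Binom-cong x n (λ i → *-comm y (ψ i))))

  vandermonde : ∀ x α β (Ψ : ℕ → Carrier) →
    Binom x α (λ m → Binom x β (λ k → Ψ (m ℕ.+ k))) ≈ Binom x (α ℕ.+ β) Ψ
  vandermonde x zero    β Ψ = Binom-zero x _
  vandermonde x (suc α) β Ψ = begin
    Binom x (suc α) inner                                   ≈⟨ Binom-suc x α inner ⟩
    Binom x α (λ m → inner (suc m) + x * inner m)
      ≈⟨ Binom-cong x α (λ m → trans (+-congˡ (Binom-*ˡ x β x _)) (sym (Binom-+ x β _ _))) ⟩
    Binom x α (λ m → Binom x β (λ k → Ψ′ (m ℕ.+ k)))        ≈⟨ vandermonde x α β Ψ′ ⟩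
    Binom x (α ℕ.+ β) Ψ′                                    ≈⟨ sym (Binom-suc x (α ℕ.+ β) Ψ) ⟩
    Binom x (suc α ℕ.+ β) Ψ                                 ∎
    where
    inner : ℕ → Carrier
    inner m = Binom x β (λ k → Ψ (m ℕ.+ k))
    Ψ′ : ℕ → Carrier
    Ψ′ k = Ψ (suc k) + x * Ψ k

  -- For Φ α k = (a)_α (c)_k, `triple M Φ` is M! times the coefficient of w^M in
  -- e^{xyw} Σ_m (a)_m (c)_m (1-yw)^{-(m+a)} (1-xw)^{-(m+c)} w^m/m!, and
  -- `double M Φ` is C_M(a,x) C_M(c,y).  The identity holds for every Φ, which
  -- lets it be applied one variable at a time.

  module OneVariable (x y : Carrier) where

    conv₁ : (ℕ → ℕ → Carrier) → ℕ → ℕ → Carrier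
    conv₁ Φ m P′ = BC P′ (λ i p → pow y i * pow x p * Φ (m ℕ.+ i) (m ℕ.+ p))

    conv₂ : (ℕ → ℕ → Carrier) → ℕ → Carrier
    conv₂ Φ P = BC P (conv₁ Φ)

    triple : ℕ → (ℕ → ℕ → Carrier) → Carrier
    triple M Φ = BC M (λ u P → pow (x * y) u * conv₂ Φ P)

    double : ℕ → (ℕ → ℕ → Carrier) → Carrier
    double M Φ = Binom x M (λ α → Binom y M (Φ α))

    -- The common recursion: raising M by one replaces Φ by `step Φ`.
    step : (ℕ → ℕ → Carrier) → ℕ → ℕ → Carrier
    step Φ α k = x * y * Φ α k + (Φ (suc α) (suc k) + (y * Φ (suc α) k + x * Φ α (suc k)))

    conv₁-cong : ∀ {Φ Ψ} → (∀ α k → Φ α k ≈ Ψ α k) → ∀ m P′ → conv₁ Φ m P′ ≈ conv₁ Ψ m P′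
    conv₁-cong Φ≈Ψ m P′ = BC-cong P′ (λ i p → *-congˡ (Φ≈Ψ _ _))

    conv₂-cong : ∀ {Φ Ψ} → (∀ α k → Φ α k ≈ Ψ α k) → ∀ P → conv₂ Φ P ≈ conv₂ Ψ P
    conv₂-cong Φ≈Ψ P = BC-cong P (conv₁-cong Φ≈Ψ)

    triple-cong : ∀ {Φ Ψ} → (∀ α k → Φ α k ≈ Ψ α k) → ∀ M → triple M Φ ≈ triple M Ψ
    triple-cong Φ≈Ψ M = BC-cong M (λ u P → *-congˡ (conv₂-cong Φ≈Ψ P))

    double-cong : ∀ {Φ Ψ} → (∀ α k → Φ α k ≈ Ψ α k) → ∀ M → double M Φ ≈ double M Ψ
    double-cong Φ≈Ψ M = Binom-cong x M (λ α → Binom-cong y M (Φ≈Ψ α))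

    conv₁-+ : ∀ Φ Ψ m P′ → conv₁ Φ m P′ + conv₁ Ψ m P′ ≈ conv₁ (λ α k → Φ α k + Ψ α k) m P′
    conv₁-+ Φ Ψ m P′ = trans (sym (BC-+ P′ _ _)) (BC-cong P′ (λ i p → sym (distribˡ _ _ _)))

    conv₂-+ : ∀ Φ Ψ P → conv₂ Φ P + conv₂ Ψ P ≈ conv₂ (λ α k → Φ α k + Ψ α k) P
    conv₂-+ Φ Ψ P = trans (sym (BC-+ P _ _)) (BC-cong P (conv₁-+ Φ Ψ))

    conv₁-*ˡ : ∀ z Φ m P′ → z * conv₁ Φ m P′ ≈ conv₁ (λ α k → z * Φ α k) m P′
    conv₁-*ˡ z Φ m P′ = trans (BC-*ˡ P′ z _) (BC-cong P′ (λ i p →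
      solve 4 (λ z a b c → z :* (a :* b :* c) := a :* b :* (z :* c)) refl z _ _ _))

    conv₂-*ˡ : ∀ z Φ P → z * conv₂ Φ P ≈ conv₂ (λ α k → z * Φ α k) P
    conv₂-*ˡ z Φ P = trans (BC-*ˡ P z _) (BC-cong P (conv₁-*ˡ z Φ))

    conv₁-suc : ∀ Φ m P′ → conv₁ Φ m (suc P′) ≈ conv₁ (λ α k → y * Φ (suc α) k + x * Φ α (suc k)) m P′
    conv₁-suc Φ m P′ = trans (BC-suc P′ _) (BC-cong P′ regroup)
      where
      regroup : ∀ i p →
        pow y (suc i) * pow x p * Φ (m ℕ.+ suc i) (m ℕ.+ p) + pow y i * pow x (suc p) * Φ (m ℕ.+ i) (m ℕ.+ suc p)
          ≈ pow y i * pow x p * (y * Φ (suc (m ℕ.+ i)) (m ℕ.+ p) + x * Φ (m ℕ.+ i) (suc (m ℕ.+ p)))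
      regroup i p = begin
        pow y (suc i) * pow x p * Φ (m ℕ.+ suc i) (m ℕ.+ p) + pow y i * pow x (suc p) * Φ (m ℕ.+ i) (m ℕ.+ suc p)
          ≈⟨ +-cong (*-congˡ (reflexive (Eq.cong (λ α → Φ α (m ℕ.+ p)) (ℕₚ.+-suc m i))))
                    (*-congˡ (reflexive (Eq.cong (Φ (m ℕ.+ i)) (ℕₚ.+-suc m p)))) ⟩
        y * pow y i * pow x p * Φ (suc (m ℕ.+ i)) (m ℕ.+ p) + pow y i * (x * pow x p) * Φ (m ℕ.+ i) (suc (m ℕ.+ p))
          ≈⟨ solve 6 (λ y x Y X a b → y :* Y :* X :* a :+ Y :* (x :* X) :* b := Y :* X :* (y :* a :+ x :* b))
                   refl y x (pow y i) (pow x p) _ _ ⟩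
        pow y i * pow x p * (y * Φ (suc (m ℕ.+ i)) (m ℕ.+ p) + x * Φ (m ℕ.+ i) (suc (m ℕ.+ p))) ∎

    conv₂-suc : ∀ Φ P →
      conv₂ Φ (suc P) ≈ conv₂ (λ α k → Φ (suc α) (suc k) + (y * Φ (suc α) k + x * Φ α (suc k))) P
    conv₂-suc Φ P = trans (BC-suc P _) (BC-cong P (λ m P′ →
      trans (+-congˡ (conv₁-suc Φ m P′)) (conv₁-+ (λ α k → Φ (suc α) (suc k)) sideSteps m P′)))
      where
      sideSteps : ℕ → ℕ → Carrier
      sideSteps α k = y * Φ (suc α) k + x * Φ α (suc k)

    triple-suc : ∀ M Φ → triple (suc M) Φ ≈ triple M (step Φ)
    triple-suc M Φ = trans (BC-suc M _) (BC-cong M (λ u P → begin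
      x * y * pow (x * y) u * conv₂ Φ P + pow (x * y) u * conv₂ Φ (suc P)
        ≈⟨ +-cong (trans (solve 3 (λ z a w → z :* a :* w := a :* (z :* w)) refl (x * y) (pow (x * y) u) (conv₂ Φ P))
                         (*-congˡ (conv₂-*ˡ (x * y) Φ P)))
                  (*-congˡ (conv₂-suc Φ P)) ⟩
      pow (x * y) u * conv₂ scaled P + pow (x * y) u * conv₂ shifted P  ≈⟨ sym (distribˡ _ _ _) ⟩
      pow (x * y) u * (conv₂ scaled P + conv₂ shifted P)                ≈⟨ *-congˡ (conv₂-+ scaled shifted P) ⟩
      pow (x * y) u * conv₂ (step Φ) P                                  ∎))
      where
      scaled shifted : ℕ → ℕ → Carrier
      scaled  α k = x * y * Φ α k
      shifted α k = Φ (suc α) (suc k) + (y * Φ (suc α) k + x * Φ α (suc k))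

    double-suc : ∀ M Φ → double (suc M) Φ ≈ double M (step Φ)
    double-suc M Φ = begin
      double (suc M) Φ                                           ≈⟨ Binom-suc x M _ ⟩
      Binom x M (λ α → Binom y (suc M) (Φ (suc α)) + x * Binom y (suc M) (Φ α))
        ≈⟨ Binom-cong x M (λ α → +-cong (Binom-suc y M _) (*-congˡ (Binom-suc y M _))) ⟩
      Binom x M (λ α → Binom y M (λ k → Φ (suc α) (suc k) + y * Φ (suc α) k)
                       + x * Binom y M (λ k → Φ α (suc k) + y * Φ α k))
        ≈⟨ Binom-cong x M (λ α → trans (+-congˡ (Binom-*ˡ y M x _)) (sym (Binom-+ y M _ _))) ⟩
      Binom x M (λ α → Binom y M (λ k → (Φ (suc α) (suc k) + y * Φ (suc α) k)
                                         + x * (Φ α (suc k) + y * Φ α k)))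
        ≈⟨ double-cong (λ α k → solve 6 (λ x y a b c d →
               (a :+ y :* b) :+ x :* (c :+ y :* d) := x :* y :* d :+ (a :+ (y :* b :+ x :* c)))
               refl x y (Φ (suc α) (suc k)) (Φ (suc α) k) (Φ α (suc k)) (Φ α k)) M ⟩
      double M (step Φ)                                          ∎

    triple≈double : ∀ M Φ → triple M Φ ≈ double M Φ
    triple≈double zero Φ = begin
      triple 0 Φ          ≈⟨ trans (BC-zero _) (*-identityˡ _) ⟩
      conv₂ Φ 0           ≈⟨ trans (BC-zero _) (BC-zero _) ⟩
      1# * 1# * Φ 0 0     ≈⟨ trans (*-congʳ (*-identityˡ 1#)) (*-identityˡ _) ⟩
      Φ 0 0               ≈⟨ sym (trans (Binom-zero x _) (Binom-zero y _)) ⟩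
      double 0 Φ          ∎
    triple≈double (suc M) Φ =
      trans (triple-suc M Φ) (trans (triple≈double M (step Φ)) (sym (double-suc M Φ)))

  module LinearPowers (p q : Carrier) where

    -- coefficient sequence of z·g
    shiftZ : (ℕ → Carrier) → ℕ → Carrier
    shiftZ g zero    = 0#
    shiftZ g (suc Q) = g Q

    lin-row : ∀ Q (g : ℕ → Carrier) → sumTo Q (λ j → lin p q 0 j * g (Q ∸ j)) ≈ q * shiftZ g Q
    lin-row zero    g = trans (zeroˡ _) (sym (zeroʳ q))
    lin-row (suc Q) g = begin
      sumTo (suc Q) (λ j → lin p q 0 j * g (suc Q ∸ j))         ≈⟨ sum-front Q _ ⟩
      0# * g (suc Q) + sumTo Q (λ j → lin p q 0 (suc j) * g (Q ∸ j))
        ≈⟨ +-cong (zeroˡ _) (sum-first-only Q (λ _ → zeroˡ _)) ⟩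
      0# + q * g Q                                              ≈⟨ +-identityˡ _ ⟩
      q * g Q                                                   ∎

    lin-⊛-zero : ∀ (G : Series) Q → (lin p q ⊛ G) 0 Q ≈ q * shiftZ (G 0) Q
    lin-⊛-zero G Q = lin-row Q (G 0)

    lin-⊛-suc : ∀ (G : Series) P Q → (lin p q ⊛ G) (suc P) Q ≈ q * shiftZ (G (suc P)) Q + p * G P Q
    lin-⊛-suc G P Q = begin
      (lin p q ⊛ G) (suc P) Q                                    ≈⟨ sum-front P _ ⟩
      sumTo Q (λ j → lin p q 0 j * G (suc P) (Q ∸ j))
        + sumTo P (λ i → sumTo Q (λ j → lin p q (suc i) j * G (P ∸ i) (Q ∸ j)))
        ≈⟨ +-cong (lin-row Q (G (suc P)))
                  (trans (sum-first-only P (λ i → sum-zero Q (λ _ _ → zeroˡ _)))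
                         (sum-first-only Q (λ _ → zeroˡ _))) ⟩
      q * shiftZ (G (suc P)) Q + p * G P Q                       ∎

    linPow-off : ∀ k P Q → P ℕ.+ Q ≢ k → powS (lin p q) k P Q ≈ 0#
    linPow-off zero    zero    zero    ne = ⊥-elim (ne Eq.refl)
    linPow-off zero    zero    (suc Q) ne = refl
    linPow-off zero    (suc P) Q       ne = refl
    linPow-off (suc k) zero    zero    ne = trans (lin-⊛-zero (powS (lin p q) k) 0) (zeroʳ q)
    linPow-off (suc k) zero    (suc Q) ne =
      trans (lin-⊛-zero (powS (lin p q) k) (suc Q)) (*≈0 q (linPow-off k 0 Q (ne ∘ Eq.cong suc)))
    linPow-off (suc k) (suc P) zero    ne =
      trans (lin-⊛-suc (powS (lin p q) k) P 0) (+≈0 (zeroʳ q) (*≈0 p (linPow-off k P 0 (ne ∘ Eq.cong suc))))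
    linPow-off (suc k) (suc P) (suc Q) ne =
      trans (lin-⊛-suc (powS (lin p q) k) P (suc Q))
            (+≈0 (*≈0 q (linPow-off k (suc P) Q (λ e → ne (Eq.cong suc (Eq.trans (ℕₚ.+-suc P Q) e)))))
                 (*≈0 p (linPow-off k P (suc Q) (ne ∘ Eq.cong suc))))

    linPow-on : ∀ P Q → powS (lin p q) (P ℕ.+ Q) P Q ≈ fromℕ ((P ℕ.+ Q) C P) * pow p P * pow q Q
    linPow-on zero zero = sym (trans (*-identityʳ _) (trans (*-identityʳ _) fromℕ-1))
    linPow-on zero (suc Q) = begin
      powS (lin p q) (suc Q) 0 (suc Q)        ≈⟨ lin-⊛-zero (powS (lin p q) Q) (suc Q) ⟩
      q * powS (lin p q) Q 0 Q                ≈⟨ *-congˡ (linPow-on 0 Q) ⟩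
      q * (fromℕ 1 * 1# * pow q Q)
        ≈⟨ solve 3 (λ q c w → q :* (c :* con 1 :* w) := c :* con 1 :* (q :* w)) refl q (fromℕ 1) (pow q Q) ⟩
      fromℕ 1 * 1# * pow q (suc Q)            ∎
    linPow-on (suc P) zero = begin
      powS (lin p q) (suc (P ℕ.+ 0)) (suc P) 0     ≈⟨ lin-⊛-suc (powS (lin p q) (P ℕ.+ 0)) P 0 ⟩
      q * 0# + p * powS (lin p q) (P ℕ.+ 0) P 0    ≈⟨ +-cong (zeroʳ q) (*-congˡ (linPow-on P 0)) ⟩
      0# + p * (fromℕ ((P ℕ.+ 0) C P) * pow p P * 1#)
        ≈⟨ +-identityˡ _ ⟩
      p * (fromℕ ((P ℕ.+ 0) C P) * pow p P * 1#)
        ≈⟨ *-congˡ (*-congʳ (*-congʳ (trans (diagonal P) (sym (diagonal (suc P)))))) ⟩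
      p * (fromℕ ((suc P ℕ.+ 0) C suc P) * pow p P * 1#)
        ≈⟨ solve 3 (λ p c w → p :* (c :* w :* con 1) := c :* (p :* w) :* con 1) refl p _ (pow p P) ⟩
      fromℕ ((suc P ℕ.+ 0) C suc P) * pow p (suc P) * 1# ∎
      where
      diagonal : ∀ n → fromℕ ((n ℕ.+ 0) C n) ≈ 1#
      diagonal n = trans (reflexive (Eq.cong (λ m → fromℕ (m C n)) (ℕₚ.+-identityʳ n)))
                         (trans (reflexive (Eq.cong fromℕ (nCn≡1 n))) fromℕ-1)
    linPow-on (suc P) (suc Q) = begin
      powS (lin p q) (suc (P ℕ.+ suc Q)) (suc P) (suc Q)          ≈⟨ lin-⊛-suc (powS (lin p q) (P ℕ.+ suc Q)) P (suc Q) ⟩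
      q * powS (lin p q) (P ℕ.+ suc Q) (suc P) Q + p * powS (lin p q) (P ℕ.+ suc Q) P (suc Q)
        ≈⟨ +-cong (*-congˡ (trans (reflexive (Eq.cong (λ k → powS (lin p q) k (suc P) Q) (ℕₚ.+-suc P Q)))
                                  (linPow-on (suc P) Q)))
                  (*-congˡ (linPow-on P (suc Q))) ⟩
      q * (fromℕ (n C suc P) * pow p (suc P) * pow q Q) + p * (fromℕ ((P ℕ.+ suc Q) C P) * pow p P * pow q (suc Q))
        ≈⟨ +-congˡ (*-congˡ (*-congʳ (*-congʳ (reflexive (Eq.cong (λ m → fromℕ (m C P)) (ℕₚ.+-suc P Q)))))) ⟩
      q * (fromℕ (n C suc P) * (p * pow p P) * pow q Q) + p * (fromℕ (n C P) * pow p P * (q * pow q Q))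
        ≈⟨ solve 6 (λ p q c₁ c₂ x y → q :* (c₁ :* (p :* x) :* y) :+ p :* (c₂ :* x :* (q :* y))
                                        := (c₂ :+ c₁) :* (p :* x) :* (q :* y))
                 refl p q (fromℕ (n C suc P)) (fromℕ (n C P)) (pow p P) (pow q Q) ⟩
      (fromℕ (n C P) + fromℕ (n C suc P)) * pow p (suc P) * pow q (suc Q)
        ≈⟨ *-congʳ (*-congʳ (sym (trans (reflexive (Eq.cong (λ m → fromℕ (m C suc P)) (Eq.cong suc (ℕₚ.+-suc P Q))))
                                        (fromℕ-pascal n P)))) ⟩
      fromℕ ((suc P ℕ.+ suc Q) C suc P) * pow p (suc P) * pow q (suc Q) ∎
      where
      n : ℕ
      n = suc (P ℕ.+ Q)

    compose-lin : ∀ f P Q → compose f (lin p q) P Q ≈ f (P ℕ.+ Q) * (fromℕ ((P ℕ.+ Q) C P) * pow p P * pow q Q)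
    compose-lin f P Q =
      trans (sum-last-only (P ℕ.+ Q) (λ k k<P+Q → *≈0 (f k) (linPow-off k P Q (λ e → ℕₚ.<⇒≢ k<P+Q (Eq.sym e)))))
            (*-congˡ (linPow-on P Q))

  -- Factorials.  From here on inv n is the inverse of n+1, so that invFact m
  -- is 1/m! and exponential convolutions become binomial ones.

  module WithInverses (inv-correct : ∀ n → fromℕ (suc n) * inv n ≈ 1#) where

    factorial-inverse : ∀ n → fromℕ (n !) * invFact n ≈ 1#
    factorial-inverse zero    = trans (*-identityʳ _) fromℕ-1
    factorial-inverse (suc n) = begin
      fromℕ (suc n ℕ.* n !) * (invFact n * inv n)       ≈⟨ *-congʳ (fromℕ-* (suc n) (n !)) ⟩
      fromℕ (suc n) * fromℕ (n !) * (invFact n * inv n)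
        ≈⟨ solve 4 (λ a b x y → (a :* b) :* (x :* y) := (a :* y) :* (b :* x)) refl
                 (fromℕ (suc n)) (fromℕ (n !)) (invFact n) (inv n) ⟩
      fromℕ (suc n) * inv n * (fromℕ (n !) * invFact n) ≈⟨ *-cong (inv-correct n) (factorial-inverse n) ⟩
      1# * 1#                                           ≈⟨ *-identityˡ 1# ⟩
      1#                                                ∎

    binomial-inverse : ∀ {n k} → k ≤ n → fromℕ (n C k) * invFact n ≈ invFact k * invFact (n ∸ k)
    binomial-inverse {n} {k} k≤n = begin
      fromℕ (n C k) * invFact n
        ≈⟨ sym (trans (*-congˡ (trans (*-cong (factorial-inverse k) (factorial-inverse (n ∸ k))) (*-identityˡ 1#)))
                      (*-identityʳ _)) ⟩
      fromℕ (n C k) * invFact n * ((k! * invFact k) * ([n∸k]! * invFact (n ∸ k)))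
        ≈⟨ solve 6 (λ b f x y X Y → b :* f :* ((X :* x) :* (Y :* y)) := b :* (X :* Y) :* f :* (x :* y))
                 refl (fromℕ (n C k)) (invFact n) (invFact k) (invFact (n ∸ k)) k! [n∸k]! ⟩
      fromℕ (n C k) * (k! * [n∸k]!) * invFact n * (invFact k * invFact (n ∸ k))
        ≈⟨ *-congʳ (*-congʳ (sym (trans (fromℕ-* (n C k) _) (*-congˡ (fromℕ-* (k !) ((n ∸ k) !)))))) ⟩
      fromℕ ((n C k) ℕ.* (k ! ℕ.* (n ∸ k) !)) * invFact n * (invFact k * invFact (n ∸ k))
        ≈⟨ *-congʳ (*-congʳ (reflexive (Eq.cong fromℕ (binomial·factorials k≤n)))) ⟩
      fromℕ (n !) * invFact n * (invFact k * invFact (n ∸ k))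
        ≈⟨ trans (*-congʳ (factorial-inverse n)) (*-identityˡ _) ⟩
      invFact k * invFact (n ∸ k) ∎
      where
      k! [n∸k]! : Carrier
      k!    = fromℕ (k !)
      [n∸k]! = fromℕ ((n ∸ k) !)

    expConv : ∀ n (g : ℕ → ℕ → Carrier) →
      sumTo n (λ i → invFact i * invFact (n ∸ i) * g i (n ∸ i)) ≈ invFact n * BC n g
    expConv n g = begin
      sumTo n (λ i → invFact i * invFact (n ∸ i) * g i (n ∸ i))
        ≈⟨ sum-cong≤ n (λ i i≤n → trans (*-congʳ (sym (binomial-inverse i≤n)))
                                        (solve 3 (λ b f x → b :* f :* x := f :* (b :* x)) refl _ _ _)) ⟩
      sumTo n (λ i → invFact n * (fromℕ (n C i) * g i (n ∸ i))) ≈⟨ sym (sum-*ˡ n _ _) ⟩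
      invFact n * sumTo n (λ i → fromℕ (n C i) * g i (n ∸ i)) ≈⟨ *-congˡ (sym (BC-unfold n g)) ⟩
      invFact n * BC n g                                      ∎

    expConv₂ : ∀ M N (K H : ℕ → ℕ → ℕ → ℕ → Carrier) →
      (∀ i j P Q → K i j P Q ≈ invFact i * invFact P * (invFact j * invFact Q * H i P j Q)) →
      sumTo M (λ i → sumTo N (λ j → K i j (M ∸ i) (N ∸ j))) ≈ invFact M * invFact N * BC² M N H
    expConv₂ M N K H K≈H = begin
      sumTo M (λ i → sumTo N (λ j → K i j (M ∸ i) (N ∸ j)))
        ≈⟨ sum-cong M (λ i → trans (sum-cong N (λ j → K≈H i j (M ∸ i) (N ∸ j))) (sym (sum-*ˡ N _ _))) ⟩
      sumTo M (λ i → invFact i * invFact (M ∸ i)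
                     * sumTo N (λ j → invFact j * invFact (N ∸ j) * H i (M ∸ i) j (N ∸ j)))
        ≈⟨ sum-cong M (λ i → *-congˡ (expConv N (H i (M ∸ i)))) ⟩
      sumTo M (λ i → invFact i * invFact (M ∸ i) * (invFact N * BC N (H i (M ∸ i))))
        ≈⟨ expConv M (λ i P → invFact N * BC N (H i P)) ⟩
      invFact M * BC M (λ i P → invFact N * BC N (H i P))
        ≈⟨ *-congˡ (sym (BC-*ˡ M (invFact N) (λ i P → BC N (H i P)))) ⟩
      invFact M * (invFact N * BC² M N H)                      ≈⟨ sym (*-assoc _ _ _) ⟩
      invFact M * invFact N * BC² M N H                        ∎

    compose-lin-divided : ∀ p q (f : ℕ → Carrier) P Q →
      compose (λ k → f k * invFact k) (lin p q) P Q
        ≈ invFact P * invFact Q * (f (P ℕ.+ Q) * pow p P * pow q Q)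
    compose-lin-divided p q f P Q = begin
      compose (λ k → f k * invFact k) (lin p q) P Q             ≈⟨ LinearPowers.compose-lin p q _ P Q ⟩
      f (P ℕ.+ Q) * invFact (P ℕ.+ Q) * (fromℕ ((P ℕ.+ Q) C P) * pow p P * pow q Q)
        ≈⟨ solve 5 (λ f i b x y → f :* i :* (b :* x :* y) := (b :* i) :* (f :* x :* y)) refl _ _ _ _ _ ⟩
      fromℕ ((P ℕ.+ Q) C P) * invFact (P ℕ.+ Q) * (f (P ℕ.+ Q) * pow p P * pow q Q)
        ≈⟨ *-congʳ (trans (binomial-inverse (ℕₚ.m≤m+n P Q))
                          (*-congˡ (reflexive (Eq.cong invFact (ℕₚ.m+n∸m≡n P Q))))) ⟩
      invFact P * invFact Q * (f (P ℕ.+ Q) * pow p P * pow q Q) ∎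

    binomS-lin : ∀ p q e P Q →
      binomS e (lin p q) P Q ≈ invFact P * invFact Q * (poch e (P ℕ.+ Q) * pow p P * pow q Q)
    binomS-lin p q e = compose-lin-divided p q (poch e)

    expS-lin : ∀ p q P Q → expS (lin p q) P Q ≈ invFact P * invFact Q * (pow p P * pow q Q)
    expS-lin p q P Q = begin
      expS (lin p q) P Q                                   ≈⟨ sum-cong (P ℕ.+ Q) (λ k → *-congʳ (sym (*-identityˡ _))) ⟩
      compose (λ k → 1# * invFact k) (lin p q) P Q         ≈⟨ compose-lin-divided p q (λ _ → 1#) P Q ⟩
      invFact P * invFact Q * (1# * pow p P * pow q Q)     ≈⟨ *-congˡ (trans (*-assoc _ _ _) (*-identityˡ _)) ⟩
      invFact P * invFact Q * (pow p P * pow q Q)          ∎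

    -- (1-ty)^{-e₁} (1-tz)^{-e₂}: a product of a series in y alone and one in z alone.
    binomS-axes : ∀ t e₁ e₂ i j →
      (binomS e₁ (lin t 0#) ⊛ binomS e₂ (lin 0# t)) i j
        ≈ invFact i * invFact j * (poch e₁ i * pow t i * (poch e₂ j * pow t j))
    binomS-axes t e₁ e₂ i j = begin
      (Y ⊛ Z) i j
        ≈⟨ sum-cong i (λ i′ → sum-first-only j (λ j′ → trans (*-congʳ (Y-y-only i′ j′)) (zeroˡ _))) ⟩
      sumTo i (λ i′ → Y i′ 0 * Z (i ∸ i′) j)
        ≈⟨ sum-last-only i (λ i′ i′<i → *≈0 (Y i′ 0) (Z-z-only (i ∸ i′) j (ℕₚ.m>n⇒m∸n≢0 i′<i))) ⟩
      Y i 0 * Z (i ∸ i) j                                   ≈⟨ *-congˡ (reflexive (Eq.cong (λ k → Z k j) (ℕₚ.n∸n≡0 i))) ⟩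
      Y i 0 * Z 0 j                                         ≈⟨ *-cong (binomS-lin t 0# e₁ i 0) (binomS-lin 0# t e₂ 0 j) ⟩
      invFact i * 1# * (poch e₁ (i ℕ.+ 0) * pow t i * 1#) * (1# * invFact j * (poch e₂ j * 1# * pow t j))
        ≈⟨ *-congʳ (*-congˡ (*-congʳ (*-congʳ (reflexive (Eq.cong (poch e₁) (ℕₚ.+-identityʳ i)))))) ⟩
      invFact i * 1# * (poch e₁ i * pow t i * 1#) * (1# * invFact j * (poch e₂ j * 1# * pow t j))
        ≈⟨ solve 6 (λ a b c d f g → a :* con 1 :* (c :* d :* con 1) :* (con 1 :* b :* (f :* con 1 :* g))
                                     := a :* b :* (c :* d :* (f :* g)))
                 refl (invFact i) (invFact j) (poch e₁ i) (pow t i) (poch e₂ j) (pow t j) ⟩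
      invFact i * invFact j * (poch e₁ i * pow t i * (poch e₂ j * pow t j)) ∎
      where
      Y Z : Series
      Y = binomS e₁ (lin t 0#)
      Z = binomS e₂ (lin 0# t)
      Y-y-only : ∀ i j → Y i (suc j) ≈ 0#
      Y-y-only i j = trans (binomS-lin t 0# e₁ i (suc j)) (*≈0 _ (*≈0 _ (zeroˡ _)))
      Z-z-only : ∀ i j → i ≢ 0 → Z i j ≈ 0#
      Z-z-only i j i≢0 =
        trans (binomS-lin 0# t e₂ i j) (*≈0 _ (trans (*-congʳ (*≈0 _ (pow-0# i i≢0))) (zeroˡ _)))

    module Assembly (a b c r s t : Carrier) where
      open import Algebra.Properties.CommutativeSemigroup ℕₚ.+-commutativeSemigroup using (interchange)

      module Y = OneVariable r t
      module Z = OneVariable s t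

      pochs : ℕ → ℕ → Carrier
      pochs m n = poch a m * poch b n * poch c (m ℕ.+ n)

      -- y^i z^j-part of (1-ty)^{-(m+a)} (1-tz)^{-(n+b)} times the y^p z^q-part
      -- of (1-ry-sz)^{-(m+n+c)}, without factorials
      kernel : ℕ → ℕ → ℕ → ℕ → ℕ → ℕ → Carrier
      kernel m n i p j q =
        poch (fromℕ m + a) i * pow t i * (poch (fromℕ n + b) j * pow t j)
          * (poch (fromℕ (m ℕ.+ n) + c) (p ℕ.+ q) * pow r p * pow s q)

      threeSeries : ℕ → ℕ → Series
      threeSeries m n = (binomS (fromℕ m + a) (lin t 0#) ⊛ binomS (fromℕ n + b) (lin 0# t))
                          ⊛ binomS (fromℕ (m ℕ.+ n) + c) (lin r s)

      family : ℕ → ℕ → Series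
      family m n = (pochs m n * invFact m * invFact n) · threeSeries m n

      familyCoeff : ℕ → ℕ → Carrier
      familyCoeff P Q = BC² P Q (λ m P₁ n Q₁ → pochs m n * BC² P₁ Q₁ (kernel m n))

      -- M! N! times the coefficient of y^M z^N on the right-hand side
      rhsCore : ℕ → ℕ → Carrier
      rhsCore M N = BC² M N (λ u P v Q → pow (r * t) u * pow (s * t) v * familyCoeff P Q)

      threeSeries-coeff : ∀ m n P Q → threeSeries m n P Q ≈ invFact P * invFact Q * BC² P Q (kernel m n)
      threeSeries-coeff m n P Q = expConv₂ P Q _ (kernel m n) (λ i j p q →
        trans (*-cong (binomS-axes t (fromℕ m + a) (fromℕ n + b) i j) (binomS-lin r s (fromℕ (m ℕ.+ n) + c) p q))
              (solve 6 (λ a b x c d y → (a :* b :* x) :* (c :* d :* y) := a :* c :* (b :* d :* (x :* y)))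
                     refl (invFact i) (invFact j) _ (invFact p) (invFact q) _))

      familySum-coeff : ∀ P Q → familySum family P Q ≈ invFact P * invFact Q * familyCoeff P Q
      familySum-coeff P Q = expConv₂ P Q (λ m n → family m n) (λ m P₁ n Q₁ → pochs m n * BC² P₁ Q₁ (kernel m n))
        (λ m n P₁ Q₁ → trans (*-congˡ (threeSeries-coeff m n P₁ Q₁))
          (solve 6 (λ w im in′ ip iq x → (w :* im :* in′) :* (ip :* iq :* x) := im :* ip :* (in′ :* iq :* (w :* x)))
                 refl (pochs m n) (invFact m) (invFact n) (invFact P₁) (invFact Q₁) (BC² P₁ Q₁ (kernel m n))))

      RHS-coeff : ∀ M N → RHS a b c r s t M N ≈ invFact M * invFact N * rhsCore M N
      RHS-coeff M N = expConv₂ M N (λ u v P Q → expS (lin (r * t) (s * t)) u v * familySum family P Q)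
        (λ u P v Q → pow (r * t) u * pow (s * t) v * familyCoeff P Q) (λ u v P Q →
        trans (*-cong (expS-lin (r * t) (s * t) u v) (familySum-coeff P Q))
          (solve 7 (λ iu iv x y ip iq k → (iu :* iv :* (x :* y)) :* (ip :* iq :* k)
                                          := iu :* ip :* (iv :* iq :* (x :* y :* k)))
                 refl (invFact u) (invFact v) (pow (r * t) u) (pow (s * t) v) (invFact P) (invFact Q) (familyCoeff P Q)))

      -- The summand of rhsCore splits into a y-part and a z-part; the rising
      -- factorials recombine by (u)_m (u+m)_i = (u)_{m+i}.
      pochTriple : ℕ → ℕ → ℕ → ℕ → Carrier
      pochTriple α k γ κ = poch a α * poch b γ * poch c (k ℕ.+ κ)

      yPart : ℕ → ℕ → ℕ → Carrier
      yPart u i p = pow (r * t) u * (pow t i * pow r p)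

      zPart : ℕ → ℕ → ℕ → ℕ → ℕ → ℕ → ℕ → Carrier
      zPart m i p v n j q = pow (s * t) v * (pow t j * pow s q * pochTriple (m ℕ.+ i) (m ℕ.+ p) (n ℕ.+ j) (n ℕ.+ q))

      regroup : ∀ u v m n i p j q →
        pow (r * t) u * pow (s * t) v * (pochs m n * kernel m n i p j q) ≈ yPart u i p * zPart m i p v n j q
      regroup u v m n i p j q = begin
        pow (r * t) u * pow (s * t) v * (pochs m n * kernel m n i p j q)
          ≈⟨ solve 12 (λ U V A B C A′ Ti B′ Tj C′ Rp Sq →
               U :* V :* (A :* B :* C :* (A′ :* Ti :* (B′ :* Tj) :* (C′ :* Rp :* Sq)))
                 := U :* (Ti :* Rp) :* (V :* (Tj :* Sq :* ((A :* A′) :* (B :* B′) :* (C :* C′))))) refl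
               (pow (r * t) u) (pow (s * t) v) (poch a m) (poch b n) (poch c (m ℕ.+ n))
               (poch (fromℕ m + a) i) (pow t i) (poch (fromℕ n + b) j) (pow t j)
               (poch (fromℕ (m ℕ.+ n) + c) (p ℕ.+ q)) (pow r p) (pow s q) ⟩
        yPart u i p * (pow (s * t) v * (pow t j * pow s q
          * (poch a m * poch (fromℕ m + a) i * (poch b n * poch (fromℕ n + b) j)
             * (poch c (m ℕ.+ n) * poch (fromℕ (m ℕ.+ n) + c) (p ℕ.+ q)))))
          ≈⟨ *-congˡ (*-congˡ (*-congˡ (*-cong (*-cong (poch-+ a m i) (poch-+ b n j))
               (trans (poch-+ c (m ℕ.+ n) (p ℕ.+ q)) (reflexive (Eq.cong (poch c) (interchange m n p q))))))) ⟩
        yPart u i p * zPart m i p v n j q ∎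

      rhsCore-expand : ∀ M N → rhsCore M N ≈
        BC² M N (λ u P v Q → BC² P Q (λ m P₁ n Q₁ → BC² P₁ Q₁ (λ i p j q → yPart u i p * zPart m i p v n j q)))
      rhsCore-expand M N = BC-cong M (λ u P → BC-cong N (λ v Q →
        trans (BC-*ˡ² (w u v) P (λ _ _ → Q) _) (BC-cong P (λ m P₁ → BC-cong Q (λ n Q₁ → begin
          w u v * (pochs m n * BC² P₁ Q₁ (kernel m n))
            ≈⟨ *-congˡ (BC-*ˡ² (pochs m n) P₁ (λ _ _ → Q₁) (kernel m n)) ⟩
          w u v * BC² P₁ Q₁ (λ i p j q → pochs m n * kernel m n i p j q)
            ≈⟨ BC-*ˡ² (w u v) P₁ (λ _ _ → Q₁) _ ⟩
          BC² P₁ Q₁ (λ i p j q → w u v * (pochs m n * kernel m n i p j q))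
            ≈⟨ BC-cong P₁ (λ i p → BC-cong Q₁ (λ j q → regroup u v m n i p j q)) ⟩
          BC² P₁ Q₁ (λ i p j q → yPart u i p * zPart m i p v n j q) ∎)))))
        where
        w : ℕ → ℕ → Carrier
        w u v = pow (r * t) u * pow (s * t) v

      -- After separating coordinates, the y-tower is a triple convolution in
      -- the y-direction whose coefficients are triple convolutions in z.
      tower≈triple : ∀ M N →
        BC M (λ u P → BC P (λ m P₁ → BC P₁ (λ i p →
          BC N (λ v Q → BC Q (λ n Q₁ → BC Q₁ (λ j q → yPart u i p * zPart m i p v n j q))))))
          ≈ Y.triple M (λ α k → Z.triple N (pochTriple α k))
      tower≈triple M N = BC-cong M (λ u P → begin
        BC P (λ m P₁ → BC P₁ (λ i p → BC N (λ v Q → BC Q (λ n Q₁ → BC Q₁ (λ j q → yPart u i p * zPart m i p v n j q)))))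
          ≈⟨ BC-cong P (λ m P₁ → BC-cong P₁ (λ i p → begin
               BC N (λ v Q → BC Q (λ n Q₁ → BC Q₁ (λ j q → yPart u i p * zPart m i p v n j q)))
                 ≈⟨ sym (BC-*ˡ³ (yPart u i p) N (λ _ Q → Q) (λ v Q n Q₁ j q → zPart m i p v n j q)) ⟩
               yPart u i p * BC N (λ v Q → BC Q (λ n Q₁ → BC Q₁ (λ j q → zPart m i p v n j q)))
                 ≈⟨ *-congˡ (BC-cong N (λ v Q → sym (BC-*ˡ² (pow (s * t) v) Q (λ _ Q₁ → Q₁) _))) ⟩
               yPart u i p * Z.triple N (pochTriple (m ℕ.+ i) (m ℕ.+ p))
                 ≈⟨ *-assoc _ _ _ ⟩
               pow (r * t) u * (pow t i * pow r p * Z.triple N (pochTriple (m ℕ.+ i) (m ℕ.+ p))) ∎)) ⟩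
        BC P (λ m P₁ → BC P₁ (λ i p → pow (r * t) u * (pow t i * pow r p * Z.triple N (pochTriple (m ℕ.+ i) (m ℕ.+ p)))))
          ≈⟨ sym (BC-*ˡ² (pow (r * t) u) P (λ _ P₁ → P₁) _) ⟩
        pow (r * t) u * Y.conv₂ (λ α k → Z.triple N (pochTriple α k)) P ∎)

      rhsCore≈product : ∀ M N →
        rhsCore M N ≈ Binom r M (poch a) * Binom s N (poch b) * Binom t (M ℕ.+ N) (poch c)
      rhsCore≈product M N = begin
        rhsCore M N                                      ≈⟨ trans (rhsCore-expand M N) (BC²-tower M N _) ⟩
        _                                                ≈⟨ tower≈triple M N ⟩
        Y.triple M (λ α k → Z.triple N (pochTriple α k)) ≈⟨ Y.triple-cong (λ α k → Z.triple≈double N (pochTriple α k)) M ⟩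
        Y.triple M (λ α k → Z.double N (pochTriple α k)) ≈⟨ Y.triple≈double M _ ⟩
        Y.double M (λ α k → Z.double N (pochTriple α k)) ≈⟨ Y.double-cong (λ α k → factor-z α k) M ⟩
        Binom r M (λ α → Binom t M (λ k → poch a α * (Bs * Gt k)))
          ≈⟨ Binom-cong r M (λ α → trans (sym (Binom-*ˡ t M (poch a α) _)) (*-congˡ (sym (Binom-*ˡ t M Bs Gt)))) ⟩
        Binom r M (λ α → poch a α * (Bs * Binom t M Gt)) ≈⟨ sym (Binom-*ʳ r M _ (poch a)) ⟩
        Binom r M (poch a) * (Bs * Binom t M Gt)         ≈⟨ *-congˡ (*-congˡ (vandermonde t M N (poch c))) ⟩
        Binom r M (poch a) * (Bs * Binom t (M ℕ.+ N) (poch c)) ≈⟨ sym (*-assoc _ _ _) ⟩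
        Binom r M (poch a) * Binom s N (poch b) * Binom t (M ℕ.+ N) (poch c) ∎
        where
        Bs : Carrier
        Bs = Binom s N (poch b)
        Gt : ℕ → Carrier
        Gt k = Binom t N (λ κ → poch c (k ℕ.+ κ))
        factor-z : ∀ α k → Z.double N (pochTriple α k) ≈ poch a α * (Bs * Gt k)
        factor-z α k = begin
          Binom s N (λ γ → Binom t N (λ κ → poch a α * poch b γ * poch c (k ℕ.+ κ)))
            ≈⟨ Binom-cong s N (λ γ → sym (Binom-*ˡ t N (poch a α * poch b γ) (λ κ → poch c (k ℕ.+ κ)))) ⟩
          Binom s N (λ γ → poch a α * poch b γ * Gt k) ≈⟨ Binom-cong s N (λ γ → *-assoc _ _ _) ⟩
          Binom s N (λ γ → poch a α * (poch b γ * Gt k)) ≈⟨ sym (Binom-*ˡ s N (poch a α) _) ⟩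
          poch a α * Binom s N (λ γ → poch b γ * Gt k)   ≈⟨ *-congˡ (sym (Binom-*ʳ s N (Gt k) (poch b))) ⟩
          poch a α * (Bs * Gt k)                         ∎


mainTheorem2 : ∀ {ℓ₁ ℓ₂ : Level} (R : CommutativeRing ℓ₁ ℓ₂) →
    let open CommutativeRing R in
    (inv : ℕ → Carrier) →
    (∀ n → FPS.fromℕ R inv (suc n) * inv n ≈ 1#) →
    ∀ (a b c r s t : Carrier) (M N : ℕ) →
    FPS.LHS R inv a b c r s t M N ≈ FPS.RHS R inv a b c r s t M N
mainTheorem2 R inv inv-correct a b c r s t M N = begin
  Cpoly M a r * Cpoly N b s * Cpoly (M ℕ.+ N) c t * invFact M * invFact N
    ≈⟨ *-congʳ (*-congʳ (*-cong (*-cong (Cpoly≈Binom M a r) (Cpoly≈Binom N b s))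
                                (Cpoly≈Binom (M ℕ.+ N) c t))) ⟩
  product * invFact M * invFact N        ≈⟨ trans (*-assoc _ _ _) (*-comm _ _) ⟩
  invFact M * invFact N * product        ≈⟨ *-congˡ (sym (rhsCore≈product M N)) ⟩
  invFact M * invFact N * rhsCore M N    ≈⟨ sym (RHS-coeff M N) ⟩
  RHS a b c r s t M N                    ∎
  where
  open CommutativeRing R
  open FPS R inv
  open Development R inv
  open WithInverses inv-correct
  open Assembly a b c r s t
  open SetoidReasoning setoid

  product : Carrier
  product = Binom r M (poch a) * Binom s N (poch b) * Binom t (M ℕ.+ N) (poch c)
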